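{- Let $n\ge 1$, $p\in(0,1)$, $q=1-p$, and let $A\subseteq[0,n-1]$ be random, each element of $[0,n-1]$ included in $A$ independently with probability $p$. For $0\le i\le n-1$ and $0\le r\le n$ write $P_r(i):=\mathbb{P}(i\notin A+A \mid |A|=r)$. Then $$\mathbb{E}[|A+A|]=\sum_{r=0}^{n}\binom{n}{r}p^r q^{n-r}\left(2\sum_{i=0}^{n-2}\bigl(1-P_r(i)\bigr)+\bigl(1-P_r(n-1)\bigr)\right),$$ where $$P_r(i)=\begin{cases}\dfrac{\sum_{k=0}^{(i+1)/2}2^k\binom{(i+1)/2}{k}\binom{n-i-1}{r-k}}{\binom{n}{r}} & \text{if } i \text{ is odd},\\[3mm] \dfrac{\sum_{k=0}^{i/2}2^k\binom{i/2}{k}\binom{n-i-1}{r-k}}{\binom{n}{r}} & \text{if } i \text{ is even}.\end{cases}$$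
   Context: $[a,b]$ denotes the set of integers $\{a,a+1,\dots,b\}$. $A+A=\{a+a' : a,a'\in A\}$. Binomial coefficients follow the convention $\binom{m}{j}=0$ when $j<0$ or $j>m$.
   Formalization: The probability p takes only rational values in the interval $(0,1)$. -}

module Defs where

open import Data.Bool using (Bool; true; false; if_then_else_; _∧_; _∨_)
open import Data.Nat as ℕ using (ℕ; zero; suc; _≤ᵇ_; _≡ᵇ_)
open import Data.Nat.DivMod using (_%_)
import Data.Nat.DivMod as ℕD
open import Data.Nat.Combinatorics using (_C_)
open import Data.Integer using (+_)
open import Data.List using (List; []; _∷_; _++_; map; foldr; upTo)
open import Data.Vec using (Vec; []; _∷_)
open import Data.Rational using (ℚ; 0ℚ; 1ℚ; _+_; _*_; _-_; _÷_; _/_; ≢-nonZero)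
open import Data.Rational.Properties using (_≟_)
open import Relation.Nullary using (yes; no)

ΣQ : ℕ → (ℕ → ℚ) → ℚ
ΣQ m f = foldr (λ i acc → f i + acc) 0ℚ (upTo m)

ΣN : ℕ → (ℕ → ℕ) → ℕ
ΣN m f = foldr (λ i acc → f i ℕ.+ acc) 0 (upTo m)

_^Q_ : ℚ → ℕ → ℚ
x ^Q zero = 1ℚ
x ^Q suc k = x * (x ^Q k)

ℕ→ℚ : ℕ → ℚ
ℕ→ℚ k = + k / 1

-- a / b for naturals (only ever used with b ≠ 0; returns 0 when b = 0)
frac : ℕ → ℕ → ℚ
frac a zero = 0ℚ
frac a (suc b) = + a / suc b

-- Subsets A ⊆ [0, n-1], encoded as Vec Bool n (entry j says whether j ∈ A)

Sub : ℕ → Set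
Sub n = Vec Bool n

allSubs : (n : ℕ) → List (Sub n)
allSubs zero = [] ∷ []
allSubs (suc n) = map (true ∷_) (allSubs n) ++ map (false ∷_) (allSubs n)

mem : {n : ℕ} → Sub n → ℕ → Bool
mem [] a = false
mem (b ∷ A) zero = b
mem (b ∷ A) (suc a) = mem A a

card : {n : ℕ} → Sub n → ℕ
card [] = 0
card (true ∷ A) = suc (card A)
card (false ∷ A) = card A

anyBelow : ℕ → (ℕ → Bool) → Bool
anyBelow m P = foldr (λ a acc → P a ∨ acc) false (upTo m)

inSumset : {n : ℕ} → Sub n → ℕ → Bool
inSumset {n} A i =
  anyBelow n (λ a → anyBelow n (λ a' → mem A a ∧ mem A a' ∧ ((a ℕ.+ a') ≡ᵇ i)))

-- |A + A| : A + A ⊆ [0, 2n-2], so count i ∈ [0, 2n-2]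
sumsetSize : {n : ℕ} → Sub n → ℕ
sumsetSize {n} A = ΣN (2 ℕ.* n ℕ.∸ 1) (λ i → if inSumset A i then 1 else 0)

-- The random set model: each element of [0, n-1] in A independently with
-- probability p.  P(A = S) = p^|S| (1-p)^(n-|S|).

weight : (n : ℕ) → ℚ → Sub n → ℚ
weight n p S = (p ^Q card S) * ((1ℚ - p) ^Q (n ℕ.∸ card S))

Pr : (n : ℕ) → ℚ → (Sub n → Bool) → ℚ
Pr n p E = ΣQ′ (allSubs n)
  where
  ΣQ′ : List (Sub n) → ℚ
  ΣQ′ [] = 0ℚ
  ΣQ′ (S ∷ Ss) = (if E S then weight n p S else 0ℚ) + ΣQ′ Ss

Ex : (n : ℕ) → ℚ → (Sub n → ℕ) → ℚ
Ex n p X = ΣE (allSubs n)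
  where
  ΣE : List (Sub n) → ℚ
  ΣE [] = 0ℚ
  ΣE (S ∷ Ss) = weight n p S * ℕ→ℚ (X S) + ΣE Ss

-- conditional probability P(E | F) = P(E ∧ F) / P(F)  (set to 0 if P(F) = 0)
CondPr : (n : ℕ) → ℚ → (Sub n → Bool) → (Sub n → Bool) → ℚ
CondPr n p E F with Pr n p F ≟ 0ℚ
... | yes _ = 0ℚ
... | no ne = (Pr n p (λ S → E S ∧ F S) ÷ Pr n p F) {{≢-nonZero ne}}

Pcond : (n : ℕ) → ℚ → ℕ → ℕ → ℚ
Pcond n p r i =
  CondPr n p (λ S → if inSumset S i then false else true) (λ S → card S ≡ᵇ r)

halfIdx : ℕ → ℕ
halfIdx i with i % 2
... | zero = i ℕD./ 2
... | suc _ = (i ℕ.+ 1) ℕD./ 2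

-- binomial coefficient C(m, j) with j = r - k possibly negative (then 0)
binomDiff : ℕ → ℕ → ℕ → ℕ
binomDiff m r k = if k ≤ᵇ r then m C (r ℕ.∸ k) else 0

Pformula : ℕ → ℕ → ℕ → ℚ
Pformula n r i =
  frac (ΣN (suc (halfIdx i))
          (λ k → (2 ℕ.^ k) ℕ.* (halfIdx i C k) ℕ.* binomDiff (n ℕ.∸ i ℕ.∸ 1) r k))
       (n C r)

module Submission where

-- Conditioned on |A| = r, every r-subset of [0, n-1] has probability p^r q^(n-r), so P_r(i) is
-- the number of r-sets S with i ∉ S + S divided by C(n, r).  For i ≤ n - 1 this only depends on
-- S ∩ [0, i]: the elements of [0, i] form ⌈i/2⌉ pairs {a, i - a}, plus the midpoint when i is
-- even, and i ∉ S + S says that S misses the midpoint and meets each pair at most once.  Choosing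
-- the k pairs that S meets (2^k C(⌈i/2⌉, k) ways) and the remaining r - k elements of S from
-- [i + 1, n - 1] gives the formula; formally, peeling off the outer pair {0, i} gives a recursion.
-- For the expectation, |A + A| = Σ_{i ≤ 2n-2} [i ∈ A + A], and the reflection a ↦ n - 1 - a
-- shows that i and 2n - 2 - i contribute equally.

module Subsets where

  open import Data.Bool using (true; false; T)
  open import Data.Nat using (zero; suc; _+_; _<_; _≤_; s≤s; z≤n; z<s)
  open import Data.Nat.Properties using (m≤n⇒m≤1+n; m<m+n; +-identityʳ; +-suc; suc-injective)
  open import Data.Vec using ([]; _∷_; _∷ʳ_; _++_; reverse)
  open import Data.Vec.Properties using (reverse-∷)
  open import Relation.Binary.PropositionalEquality
  open import Defs using (Sub; mem; card)

  card≤n : ∀ {n} (S : Sub n) → card S ≤ n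
  card≤n []          = z≤n
  card≤n (true ∷ S)  = s≤s (card≤n S)
  card≤n (false ∷ S) = m≤n⇒m≤1+n (card≤n S)

  card-++ : ∀ {k t} (u : Sub k) (v : Sub t) → card (u ++ v) ≡ card u + card v
  card-++ []          v = refl
  card-++ (true ∷ u)  v = cong suc (card-++ u v)
  card-++ (false ∷ u) v = card-++ u v

  card-∷ʳ : ∀ {n} (S : Sub n) b → card (S ∷ʳ b) ≡ card (b ∷ S)
  card-∷ʳ []          b     = refl
  card-∷ʳ (true ∷ S)  true  = cong suc (card-∷ʳ S true)
  card-∷ʳ (true ∷ S)  false = cong suc (card-∷ʳ S false)
  card-∷ʳ (false ∷ S) true  = card-∷ʳ S true
  card-∷ʳ (false ∷ S) false = card-∷ʳ S false

  card-reverse : ∀ {n} (S : Sub n) → card (reverse S) ≡ card S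
  card-reverse []          = refl
  card-reverse (true ∷ S)  rewrite reverse-∷ true S =
    trans (card-∷ʳ (reverse S) true) (cong suc (card-reverse S))
  card-reverse (false ∷ S) rewrite reverse-∷ false S =
    trans (card-∷ʳ (reverse S) false) (card-reverse S)

  mem⇒< : ∀ {n} (S : Sub n) a → T (mem S a) → a < n
  mem⇒< (b ∷ S) zero    _ = s≤s z≤n
  mem⇒< (b ∷ S) (suc a) t = s≤s (mem⇒< S a t)

  mem-++ : ∀ {k t} (u : Sub k) (v : Sub t) {a} → a < k → mem (u ++ v) a ≡ mem u a
  mem-++ (b ∷ u) v {zero}  _         = refl
  mem-++ (b ∷ u) v {suc a} (s≤s a<k) = mem-++ u v a<k

  mem-∷ʳ-< : ∀ {n} (S : Sub n) b {a} → a < n → mem (S ∷ʳ b) a ≡ mem S a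
  mem-∷ʳ-< (x ∷ S) b {zero}  _         = refl
  mem-∷ʳ-< (x ∷ S) b {suc a} (s≤s a<n) = mem-∷ʳ-< S b a<n

  mem-∷ʳ-last : ∀ {n} (S : Sub n) b → mem (S ∷ʳ b) n ≡ b
  mem-∷ʳ-last []      b = refl
  mem-∷ʳ-last (x ∷ S) b = mem-∷ʳ-last S b

  mem-reverse : ∀ {n} (S : Sub n) {a a′} → suc (a + a′) ≡ n → mem (reverse S) a ≡ mem S a′
  mem-reverse (b ∷ S) {a} {zero} eq
    rewrite reverse-∷ b S | +-identityʳ a | suc-injective eq = mem-∷ʳ-last (reverse S) b
  mem-reverse {suc n} (b ∷ S) {a} {suc a′} eq rewrite reverse-∷ b S =
    trans (mem-∷ʳ-< (reverse S) b a<n) (mem-reverse S (trans (sym (+-suc a a′)) (suc-injective eq)))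
    where
    a<n : a < n
    a<n = subst (a <_) (suc-injective eq) (m<m+n a z<s)

module FiniteSums where

  open import Algebra.Bundles using (CommutativeSemigroup)
  open import Algebra.Core using (Op₂)
  open import Algebra.Structures using (IsCommutativeMonoid)
  open import Data.Bool using (true; false; if_then_else_)
  open import Data.List using (List; []; _∷_; _++_; _∷ʳ_; foldr; map; upTo; applyUpTo)
  open import Data.List.Membership.Propositional using (_∈_)
  open import Data.List.Membership.Propositional.Properties using (∈-upTo⁻)
  open import Data.List.Properties using (foldr-map; map-upTo; upTo-∷ʳ)
  open import Data.List.Relation.Unary.Any using (here; there)
  open import Data.Nat using (ℕ; zero; suc; _+_; _∸_; _<_; _≡ᵇ_; s≤s)
  open import Data.Vec using ([]; _∷_; reverse) renaming (_∷ʳ_ to _∷ʳᵥ_; _++_ to _++ᵥ_)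
  open import Data.Vec.Properties using (reverse-∷)
  open import Function using (_∘_; flip)
  open import Level using (0ℓ)
  open import Relation.Binary.PropositionalEquality
  open import Defs using (Sub; allSubs; card)
  open Subsets using (card≤n)

  module Sums {A : Set} {_∙_ : Op₂ A} {ε : A}
              (isCommutativeMonoid : IsCommutativeMonoid _≡_ _∙_ ε) where

    open IsCommutativeMonoid isCommutativeMonoid
      using (assoc; comm; identityˡ; identityʳ; isCommutativeSemigroup)

    private
      commutativeSemigroup : CommutativeSemigroup 0ℓ 0ℓ
      commutativeSemigroup = record { isCommutativeSemigroup = isCommutativeSemigroup }

    open import Algebra.Properties.CommutativeSemigroup commutativeSemigroup using (interchange)
    open ≡-Reasoning

    sumList : {I : Set} → List I → (I → A) → A
    sumList xs f = foldr (λ i acc → f i ∙ acc) ε xs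

    -- For _+_ on ℕ and ℚ, sumUpTo is definitionally Defs.ΣN and Defs.ΣQ.
    sumUpTo : ℕ → (ℕ → A) → A
    sumUpTo m = sumList (upTo m)

    sumSubsets : (n : ℕ) → (Sub n → A) → A
    sumSubsets zero    f = f []
    sumSubsets (suc n) f = sumSubsets n (f ∘ (true ∷_)) ∙ sumSubsets n (f ∘ (false ∷_))

    module _ {I : Set} where

      sumList-cong : ∀ (xs : List I) {f g} → (∀ {i} → i ∈ xs → f i ≡ g i) →
                     sumList xs f ≡ sumList xs g
      sumList-cong []       eq = refl
      sumList-cong (x ∷ xs) eq = cong₂ _∙_ (eq (here refl)) (sumList-cong xs (eq ∘ there))

      sumList-ε : ∀ (xs : List I) → sumList xs (λ _ → ε) ≡ ε
      sumList-ε []       = refl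
      sumList-ε (x ∷ xs) = trans (identityˡ _) (sumList-ε xs)

      sumList-∙ : ∀ (xs : List I) f g →
                  sumList xs (λ i → f i ∙ g i) ≡ sumList xs f ∙ sumList xs g
      sumList-∙ []       f g = sym (identityˡ ε)
      sumList-∙ (x ∷ xs) f g = trans (cong (_ ∙_) (sumList-∙ xs f g)) (interchange _ _ _ _)

      sumList-++ : ∀ (xs ys : List I) f → sumList (xs ++ ys) f ≡ sumList xs f ∙ sumList ys f
      sumList-++ []       ys f = sym (identityˡ _)
      sumList-++ (x ∷ xs) ys f = trans (cong (f x ∙_) (sumList-++ xs ys f)) (sym (assoc _ _ _))

    sumUpTo-cong : ∀ m {f g} → (∀ {i} → i < m → f i ≡ g i) → sumUpTo m f ≡ sumUpTo m g
    sumUpTo-cong m eq = sumList-cong (upTo m) (eq ∘ ∈-upTo⁻)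

    sumUpTo-suc : ∀ m f → sumUpTo (suc m) f ≡ f 0 ∙ sumUpTo m (f ∘ suc)
    sumUpTo-suc m f = cong (f 0 ∙_) (begin
      sumList (applyUpTo suc m) f   ≡⟨ cong (flip sumList f) (map-upTo suc m) ⟨
      sumList (map suc (upTo m)) f  ≡⟨ foldr-map _ suc ε (upTo m) ⟩
      sumUpTo m (f ∘ suc)           ∎)

    sumUpTo-sucʳ : ∀ m f → sumUpTo (suc m) f ≡ sumUpTo m f ∙ f m
    sumUpTo-sucʳ m f = begin
      sumList (upTo (suc m)) f  ≡⟨ cong (flip sumList f) (upTo-∷ʳ m) ⟨
      sumList (upTo m ∷ʳ m) f   ≡⟨ sumList-++ (upTo m) (m ∷ []) f ⟩
      sumUpTo m f ∙ (f m ∙ ε)   ≡⟨ cong (sumUpTo m f ∙_) (identityʳ (f m)) ⟩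
      sumUpTo m f ∙ f m         ∎

    sumUpTo-+ : ∀ a b f → sumUpTo (a + b) f ≡ sumUpTo a f ∙ sumUpTo b (f ∘ (a +_))
    sumUpTo-+ zero    b f = sym (identityˡ _)
    sumUpTo-+ (suc a) b f = begin
      sumUpTo (suc (a + b)) f             ≡⟨ sumUpTo-suc (a + b) f ⟩
      f 0 ∙ sumUpTo (a + b) (f ∘ suc)     ≡⟨ cong (f 0 ∙_) (sumUpTo-+ a b (f ∘ suc)) ⟩
      f 0 ∙ (sumUpTo a (f ∘ suc) ∙ rest)  ≡⟨ assoc _ _ _ ⟨
      (f 0 ∙ sumUpTo a (f ∘ suc)) ∙ rest  ≡⟨ cong (_∙ rest) (sumUpTo-suc a f) ⟨
      sumUpTo (suc a) f ∙ rest            ∎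
      where
      rest : A
      rest = sumUpTo b (f ∘ (suc a +_))

    sumUpTo-reverse : ∀ m f → sumUpTo m (λ j → f (m ∸ suc j)) ≡ sumUpTo m f
    sumUpTo-reverse zero    f = refl
    sumUpTo-reverse (suc m) f = begin
      sumUpTo (suc m) (λ j → f (suc m ∸ suc j))  ≡⟨ sumUpTo-suc m _ ⟩
      f m ∙ sumUpTo m (λ j → f (m ∸ suc j))      ≡⟨ cong (f m ∙_) (sumUpTo-reverse m f) ⟩
      f m ∙ sumUpTo m f                          ≡⟨ comm _ _ ⟩
      sumUpTo m f ∙ f m                          ≡⟨ sumUpTo-sucʳ m f ⟨
      sumUpTo (suc m) f                          ∎

    sumUpTo-indicator : ∀ {c m} x → c < m → sumUpTo m (λ r → if c ≡ᵇ r then x else ε) ≡ x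
    sumUpTo-indicator {zero} {suc m} x _ = begin
      sumUpTo (suc m) (λ r → if 0 ≡ᵇ r then x else ε)  ≡⟨ sumUpTo-suc m _ ⟩
      x ∙ sumUpTo m (λ _ → ε)                         ≡⟨ cong (x ∙_) (sumList-ε (upTo m)) ⟩
      x ∙ ε                                           ≡⟨ identityʳ x ⟩
      x                                               ∎
    sumUpTo-indicator {suc c} {suc m} x (s≤s c<m) =
      trans (sumUpTo-suc m _) (trans (identityˡ _) (sumUpTo-indicator x c<m))

    sumSubsets-cong : ∀ n {f g : Sub n → A} → (∀ S → f S ≡ g S) →
                      sumSubsets n f ≡ sumSubsets n g
    sumSubsets-cong zero    eq = eq []
    sumSubsets-cong (suc n) eq =
      cong₂ _∙_ (sumSubsets-cong n (eq ∘ (true ∷_))) (sumSubsets-cong n (eq ∘ (false ∷_)))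

    sumSubsets-ε : ∀ n → sumSubsets n (λ _ → ε) ≡ ε
    sumSubsets-ε zero    = refl
    sumSubsets-ε (suc n) = trans (cong₂ _∙_ (sumSubsets-ε n) (sumSubsets-ε n)) (identityˡ ε)

    sumSubsets-∙ : ∀ n (f g : Sub n → A) →
                   sumSubsets n (λ S → f S ∙ g S) ≡ sumSubsets n f ∙ sumSubsets n g
    sumSubsets-∙ zero    f g = refl
    sumSubsets-∙ (suc n) f g =
      trans (cong₂ _∙_ (sumSubsets-∙ n _ _) (sumSubsets-∙ n _ _)) (interchange _ _ _ _)

    sumSubsets-sumList : ∀ n {I : Set} (xs : List I) (F : Sub n → I → A) →
      sumSubsets n (λ S → sumList xs (F S)) ≡ sumList xs (λ i → sumSubsets n (flip F i))
    sumSubsets-sumList n []       F = sumSubsets-ε n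
    sumSubsets-sumList n (x ∷ xs) F =
      trans (sumSubsets-∙ n _ _) (cong (_ ∙_) (sumSubsets-sumList n xs F))

    sumSubsets-++ : ∀ a b (f : Sub (a + b) → A) →
                    sumSubsets (a + b) f ≡ sumSubsets a (λ u → sumSubsets b (λ v → f (u ++ᵥ v)))
    sumSubsets-++ zero    b f = refl
    sumSubsets-++ (suc a) b f = cong₂ _∙_ (sumSubsets-++ a b _) (sumSubsets-++ a b _)

    sumSubsets-∷ʳ : ∀ n (f : Sub (suc n) → A) →
      sumSubsets (suc n) f ≡ sumSubsets n (f ∘ (_∷ʳᵥ true)) ∙ sumSubsets n (f ∘ (_∷ʳᵥ false))
    sumSubsets-∷ʳ zero    f = refl
    sumSubsets-∷ʳ (suc n) f = trans
      (cong₂ _∙_ (sumSubsets-∷ʳ n (f ∘ (true ∷_))) (sumSubsets-∷ʳ n (f ∘ (false ∷_))))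
      (interchange _ _ _ _)

    sumSubsets-reverse : ∀ n (f : Sub n → A) → sumSubsets n (f ∘ reverse) ≡ sumSubsets n f
    sumSubsets-reverse zero    f = refl
    sumSubsets-reverse (suc n) f = begin
      sumSubsets n (f ∘ reverse ∘ (true ∷_)) ∙ sumSubsets n (f ∘ reverse ∘ (false ∷_))
        ≡⟨ cong₂ _∙_ (sumSubsets-cong n (cong f ∘ reverse-∷ true))
                     (sumSubsets-cong n (cong f ∘ reverse-∷ false)) ⟩
      sumSubsets n (f ∘ (_∷ʳᵥ true) ∘ reverse) ∙ sumSubsets n (f ∘ (_∷ʳᵥ false) ∘ reverse)
        ≡⟨ cong₂ _∙_ (sumSubsets-reverse n _) (sumSubsets-reverse n _) ⟩
      sumSubsets n (f ∘ (_∷ʳᵥ true)) ∙ sumSubsets n (f ∘ (_∷ʳᵥ false))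
        ≡⟨ sumSubsets-∷ʳ n f ⟨
      sumSubsets (suc n) f ∎

    sumList-allSubs : ∀ n (f : Sub n → A) → sumList (allSubs n) f ≡ sumSubsets n f
    sumList-allSubs zero    f = identityʳ (f [])
    sumList-allSubs (suc n) f = begin
      sumList (map (true ∷_) (allSubs n) ++ map (false ∷_) (allSubs n)) f
        ≡⟨ sumList-++ (map (true ∷_) (allSubs n)) _ f ⟩
      sumList (map (true ∷_) (allSubs n)) f ∙ sumList (map (false ∷_) (allSubs n)) f
        ≡⟨ cong₂ _∙_ (foldr-map _ (true ∷_) ε (allSubs n))
                     (foldr-map _ (false ∷_) ε (allSubs n)) ⟩
      sumList (allSubs n) (f ∘ (true ∷_)) ∙ sumList (allSubs n) (f ∘ (false ∷_))
        ≡⟨ cong₂ _∙_ (sumList-allSubs n _) (sumList-allSubs n _) ⟩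
      sumSubsets (suc n) f ∎

    sumSubsets-byCard : ∀ n (f : Sub n → A) → sumSubsets n f ≡
      sumUpTo (suc n) (λ r → sumSubsets n (λ S → if card S ≡ᵇ r then f S else ε))
    sumSubsets-byCard n f = trans
      (sumSubsets-cong n (λ S → sym (sumUpTo-indicator (f S) (s≤s (card≤n S)))))
      (sumSubsets-sumList n (upTo (suc n)) _)

  module SumHomomorphism
    {A B : Set} {_∙_ : Op₂ A} {ε : A} {_◦_ : Op₂ B} {ε′ : B}
    (M : IsCommutativeMonoid _≡_ _∙_ ε) (N : IsCommutativeMonoid _≡_ _◦_ ε′)
    (h : A → B) (h-ε : h ε ≡ ε′) (h-∙ : ∀ x y → h (x ∙ y) ≡ h x ◦ h y) where

    private
      module ΣA = Sums M
      module ΣB = Sums N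

    sumList-homo : ∀ {I : Set} (xs : List I) f → h (ΣA.sumList xs f) ≡ ΣB.sumList xs (h ∘ f)
    sumList-homo []       f = h-ε
    sumList-homo (x ∷ xs) f = trans (h-∙ _ _) (cong (h (f x) ◦_) (sumList-homo xs f))

    sumSubsets-homo : ∀ n f → h (ΣA.sumSubsets n f) ≡ ΣB.sumSubsets n (h ∘ f)
    sumSubsets-homo zero    f = refl
    sumSubsets-homo (suc n) f =
      trans (h-∙ _ _) (cong₂ _◦_ (sumSubsets-homo n _) (sumSubsets-homo n _))

module Sumsets where

  open import Algebra.Properties.CommutativeSemigroup using (interchange)
  open import Data.Bool using (true; false; T; _∧_; _∨_)
  open import Data.Bool.ListAction using (any)
  open import Data.Bool.Properties using (T-∧; T-∨)
  open import Data.Empty using (⊥-elim)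
  open import Data.List using (upTo)
  open import Data.List.Membership.Propositional using (find; lose)
  open import Data.List.Membership.Propositional.Properties using (∈-upTo⁺; ∈-upTo⁻)
  open import Data.List.Properties using (foldr-map)
  open import Data.List.Relation.Unary.Any.Properties using (any⁺; any⁻)
  open import Data.Nat using (ℕ; zero; suc; _+_; _∸_; _<_; _≤_; s≤s)
  open import Data.Nat.Properties
  open import Data.Product using (∃-syntax; ∃₂; _×_; _,_)
  open import Data.Sum using (_⊎_; inj₁; inj₂)
  open import Data.Vec using (_∷_; _∷ʳ_; _++_; reverse)
  open import Data.Vec.Properties using (reverse-involutive)
  open import Function using (_∘_; _⇔_; mk⇔; Equivalence)
  open import Relation.Binary.PropositionalEquality
  open import Defs using (Sub; mem; anyBelow; inSumset)
  open Subsets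

  anyBelow≡any : ∀ m P → anyBelow m P ≡ any P (upTo m)
  anyBelow≡any m P = sym (foldr-map _ P false (upTo m))

  anyBelow⁻ : ∀ m P → T (anyBelow m P) → ∃[ a ] a < m × T (P a)
  anyBelow⁻ m P t with a , a∈ , Pa ← find (any⁻ P (upTo m) (subst T (anyBelow≡any m P) t)) =
    a , ∈-upTo⁻ a∈ , Pa

  anyBelow⁺ : ∀ m P {a} → a < m → T (P a) → T (anyBelow m P)
  anyBelow⁺ m P a<m Pa = subst T (sym (anyBelow≡any m P)) (any⁺ P (lose (∈-upTo⁺ a<m) Pa))

  IsSumOfTwo : ∀ {n} → Sub n → ℕ → Set
  IsSumOfTwo S i = ∃₂ λ a b → T (mem S a) × T (mem S b) × a + b ≡ i

  inSumset⁻ : ∀ {n} (S : Sub n) i → T (inSumset S i) → IsSumOfTwo S i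
  inSumset⁻ {n} S i t
    with a , _ , ta ← anyBelow⁻ n _ t
    with b , _ , tab ← anyBelow⁻ n _ ta
    with ma , tb ← Equivalence.to T-∧ tab
    with mb , a+b≡ᵇi ← Equivalence.to T-∧ tb
    = a , b , ma , mb , ≡ᵇ⇒≡ (a + b) i a+b≡ᵇi

  inSumset⁺ : ∀ {n} (S : Sub n) i → IsSumOfTwo S i → T (inSumset S i)
  inSumset⁺ {n} S i (a , b , ma , mb , a+b≡i) =
    anyBelow⁺ n _ (mem⇒< S a ma) (anyBelow⁺ n _ (mem⇒< S b mb)
      (Equivalence.from T-∧ (ma , Equivalence.from T-∧ (mb , ≡⇒≡ᵇ (a + b) i a+b≡i))))

  T⇔T⇒≡ : ∀ {x y} → T x ⇔ T y → x ≡ y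
  T⇔T⇒≡ {false} {false} _   = refl
  T⇔T⇒≡ {false} {true}  x⇔y = ⊥-elim (Equivalence.from x⇔y _)
  T⇔T⇒≡ {true}  {false} x⇔y = ⊥-elim (Equivalence.to x⇔y _)
  T⇔T⇒≡ {true}  {true}  _   = refl

  inSumset-cong : ∀ {m n} (S : Sub m) (S′ : Sub n) {i j} →
                  IsSumOfTwo S i ⇔ IsSumOfTwo S′ j → inSumset S i ≡ inSumset S′ j
  inSumset-cong S S′ {i} {j} S⇔S′ = T⇔T⇒≡ (mk⇔
    (inSumset⁺ S′ j ∘ Equivalence.to S⇔S′ ∘ inSumset⁻ S i)
    (inSumset⁺ S i ∘ Equivalence.from S⇔S′ ∘ inSumset⁻ S′ j))

  AgreeUpTo : ∀ {m n} → ℕ → Sub m → Sub n → Set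
  AgreeUpTo i S S′ = ∀ {a} → a ≤ i → mem S a ≡ mem S′ a

  inSumset-local : ∀ {m n} (S : Sub m) (S′ : Sub n) i → AgreeUpTo i S S′ →
                   inSumset S i ≡ inSumset S′ i
  inSumset-local S S′ i agree =
    inSumset-cong S S′ (mk⇔ (transport S S′ agree) (transport S′ S (sym ∘ agree)))
    where
    transport : ∀ {m n} (S : Sub m) (S′ : Sub n) → AgreeUpTo i S S′ →
                IsSumOfTwo S i → IsSumOfTwo S′ i
    transport _ _ agree (a , b , ma , mb , refl) =
      a , b , subst T (agree (m≤m+n a b)) ma , subst T (agree (m≤n+m b a)) mb , refl

  inSumset-++ : ∀ {k t} (u : Sub k) (v : Sub t) i → i < k → inSumset (u ++ v) i ≡ inSumset u i
  inSumset-++ u v i i<k = inSumset-local (u ++ v) u i (λ a≤i → mem-++ u v (≤-<-trans a≤i i<k))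

  inSumset-reverse : ∀ N (S : Sub (suc N)) {i j} → i + j ≡ N + N →
                     inSumset (reverse S) i ≡ inSumset S j
  inSumset-reverse N S {i} {j} i+j≡2N = inSumset-cong (reverse S) S (mk⇔
    (reflect S i+j≡2N)
    (reflect (reverse S) (trans (+-comm j i) i+j≡2N)
      ∘ subst (λ S′ → IsSumOfTwo S′ j) (sym (reverse-involutive S))))
    where
    reflect : ∀ (S : Sub (suc N)) {k l} → k + l ≡ N + N →
              IsSumOfTwo (reverse S) k → IsSumOfTwo S l
    reflect S {k} {l} k+l≡2N (a , b , ma , mb , a+b≡k) =
      N ∸ a , N ∸ b ,
      subst T (mem-reverse S (cong suc a+[N∸a]≡N)) ma ,
      subst T (mem-reverse S (cong suc b+[N∸b]≡N)) mb ,
      +-cancelˡ-≡ k _ _ (begin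
        k + ((N ∸ a) + (N ∸ b))        ≡⟨ cong (_+ _) a+b≡k ⟨
        (a + b) + ((N ∸ a) + (N ∸ b))  ≡⟨ interchange +-commutativeSemigroup a b (N ∸ a) (N ∸ b) ⟩
        (a + (N ∸ a)) + (b + (N ∸ b))  ≡⟨ cong₂ _+_ a+[N∸a]≡N b+[N∸b]≡N ⟩
        N + N                          ≡⟨ k+l≡2N ⟨
        k + l                          ∎)
      where
      open ≡-Reasoning
      a+[N∸a]≡N : a + (N ∸ a) ≡ N
      a+[N∸a]≡N = m+[n∸m]≡n (≤-pred (mem⇒< (reverse S) a ma))
      b+[N∸b]≡N : b + (N ∸ b) ≡ N
      b+[N∸b]≡N = m+[n∸m]≡n (≤-pred (mem⇒< (reverse S) b mb))

  inSumset-outerPair : ∀ i b b′ (w : Sub (suc i)) →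
                       inSumset (b ∷ (w ∷ʳ b′)) (2 + i) ≡ (b ∧ b′) ∨ inSumset w i
  inSumset-outerPair i b b′ w = T⇔T⇒≡ (mk⇔
    (Equivalence.from T-∨ ∘ classify ∘ inSumset⁻ u (2 + i))
    (build ∘ Equivalence.to T-∨))
    where
    u : Sub (3 + i)
    u = b ∷ (w ∷ʳ b′)

    inner : ∀ {x} → x < suc i → mem u (suc x) ≡ mem w x
    inner = mem-∷ʳ-< w b′

    outer : ∀ {c} → T (mem u 0) → T (mem u c) → c ≡ 2 + i → T (b ∧ b′)
    outer mb mc refl = Equivalence.from T-∧ (mb , subst T (mem-∷ʳ-last w b′) mc)

    classify : IsSumOfTwo u (2 + i) → T (b ∧ b′) ⊎ T (inSumset w i)
    classify (zero  , c     , ma , mc , eq) = inj₁ (outer ma mc eq)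
    classify (suc x , zero  , ma , mc , eq) = inj₁ (outer mc ma (trans (sym (+-identityʳ _)) eq))
    classify (suc x , suc y , ma , mc , eq) = inj₂ (inSumset⁺ w i
      (x , y , subst T (inner (s≤s (m+n≤o⇒m≤o x (≤-reflexive x+y≡i)))) ma ,
               subst T (inner (s≤s (m+n≤o⇒n≤o x (≤-reflexive x+y≡i)))) mc , x+y≡i))
      where
      x+y≡i : x + y ≡ i
      x+y≡i = suc-injective (trans (sym (+-suc x y)) (suc-injective eq))

    build : T (b ∧ b′) ⊎ T (inSumset w i) → T (inSumset u (2 + i))
    build (inj₁ tbb′) with mb , mb′ ← Equivalence.to T-∧ tbb′ =
      inSumset⁺ u (2 + i) (0 , 2 + i , mb , subst T (sym (mem-∷ʳ-last w b′)) mb′ , refl)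
    build (inj₂ tw) with x , y , mx , my , refl ← inSumset⁻ w i tw =
      inSumset⁺ u (2 + i) (suc x , suc y , subst T (sym (inner (mem⇒< w x mx))) mx ,
                                           subst T (sym (inner (mem⇒< w y my))) my ,
                                           cong suc (+-suc x y))

module Counting where

  open import Data.Bool using (Bool; true; false; if_then_else_; _∧_; _∨_)
  open import Data.List using (upTo)
  open import Data.Nat using (ℕ; zero; suc; _+_; _*_; _∸_; _^_; _<_; _≤_; _>_; s≤s; z≤n; _≡ᵇ_; _≤ᵇ_)
  open import Data.Nat.Combinatorics using (_C_; nCk+nC[k+1]≡[n+1]C[k+1])
  open import Data.Nat.Combinatorics.Specification using (k>n⇒nCk≡0)
  open import Data.Nat.DivMod using (_%_; m/n≡1+[m∸n]/n)
  open import Data.Nat.Properties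
  open import Data.Nat.Solver using (module +-*-Solver)
  open import Data.Product using (_,_)
  open import Data.Vec using (_∷_; _∷ʳ_; _++_)
  open import Function using (_∘_)
  open import Relation.Binary.PropositionalEquality
  open import Defs using (Sub; card; inSumset; sumsetSize; halfIdx; binomDiff)
  open Subsets
  open FiniteSums
  open Sumsets

  module Σℕ = Sums +-0-isCommutativeMonoid
  module Scaleℕ (c : ℕ) = SumHomomorphism
    +-0-isCommutativeMonoid +-0-isCommutativeMonoid (c *_) (*-zeroʳ c) (*-distribˡ-+ c)
  open Σℕ using (sumUpTo; sumSubsets)

  count : (n : ℕ) → (Sub n → Bool) → ℕ
  count n B = sumSubsets n (λ S → if B S then 1 else 0)

  count-card : ∀ t s → count t (λ v → card v ≡ᵇ s) ≡ t C s
  count-card zero    zero    = refl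
  count-card zero    (suc s) = refl
  count-card (suc t) zero    =
    trans (cong (_+ count t (λ v → card v ≡ᵇ 0)) (Σℕ.sumSubsets-ε t)) (count-card t 0)
  count-card (suc t) (suc s) =
    trans (cong₂ _+_ (count-card t s) (count-card t (suc s))) (nCk+nC[k+1]≡[n+1]C[k+1] t s)

  +≡ᵇ-shift : ∀ c x r → (c + x ≡ᵇ r) ≡ (if c ≤ᵇ r then x ≡ᵇ r ∸ c else false)
  +≡ᵇ-shift zero          x r       = refl
  +≡ᵇ-shift (suc c)       x zero    = refl
  +≡ᵇ-shift (suc zero)    x (suc r) = +≡ᵇ-shift zero x r
  +≡ᵇ-shift (suc (suc c)) x (suc r) = +≡ᵇ-shift (suc c) x r

  nCk>0 : ∀ {n k} → k ≤ n → n C k > 0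
  nCk>0 {n}     {zero}  _         = s≤s z≤n
  nCk>0 {suc n} {suc k} (s≤s k≤n) = <-≤-trans (nCk>0 k≤n)
    (≤-trans (m≤m+n (n C k) (n C suc k)) (≤-reflexive (nCk+nC[k+1]≡[n+1]C[k+1] n k)))

  count-card-offset : ∀ t c r → count t (λ v → c + card v ≡ᵇ r) ≡ binomDiff t r c
  count-card-offset t c r =
    trans (Σℕ.sumSubsets-cong t (λ v → cong (λ b → if b then 1 else 0) (+≡ᵇ-shift c (card v) r)))
          (byCases (c ≤ᵇ r))
    where
    byCases : ∀ b → count t (λ v → if b then card v ≡ᵇ r ∸ c else false)
                    ≡ (if b then t C (r ∸ c) else 0)
    byCases true  = count-card t (r ∸ c)
    byCases false = Σℕ.sumSubsets-ε t

  count-split : ∀ n (E F : Sub n → Bool) →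
    count n F ≡ count n (λ S → (if E S then false else true) ∧ F S) + count n (λ S → F S ∧ E S)
  count-split n E F =
    trans (Σℕ.sumSubsets-cong n (λ S → split (E S) (F S))) (Σℕ.sumSubsets-∙ n _ _)
    where
    split : ∀ e f → (if f then 1 else 0)
                    ≡ (if (if e then false else true) ∧ f then 1 else 0) + (if f ∧ e then 1 else 0)
    split true  true  = refl
    split true  false = refl
    split false true  = refl
    split false false = refl

  -- 2^k C(h, k) counts the sets that meet exactly k of h disjoint pairs, each in one element.
  transversalTerm : ℕ → (ℕ → ℕ) → ℕ → ℕ
  transversalTerm h g k = 2 ^ k * (h C k) * g k

  transversalSum : ℕ → (ℕ → ℕ) → ℕ
  transversalSum h g = sumUpTo (suc h) (transversalTerm h g)

  transversalTerm-pascal : ∀ h g k → transversalTerm (suc h) g (suc k)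
                           ≡ 2 * transversalTerm h (g ∘ suc) k + transversalTerm h g (suc k)
  transversalTerm-pascal h g k rewrite sym (nCk+nC[k+1]≡[n+1]C[k+1] h k) =
    solve 4 (λ p a b x → (con 2 :* p) :* (a :+ b) :* x
                         := con 2 :* (p :* a :* x) :+ (con 2 :* p) :* b :* x)
          refl (2 ^ k) (h C k) (h C suc k) (g (suc k))
    where open +-*-Solver

  transversalSum-extend : ∀ h g → sumUpTo (2 + h) (transversalTerm h g) ≡ transversalSum h g
  transversalSum-extend h g = begin
    sumUpTo (2 + h) (transversalTerm h g)
      ≡⟨ Σℕ.sumUpTo-sucʳ (suc h) (transversalTerm h g) ⟩
    transversalSum h g + 2 ^ suc h * (h C suc h) * g (suc h)
      ≡⟨ cong (λ c → transversalSum h g + 2 ^ suc h * c * g (suc h)) (k>n⇒nCk≡0 (n<1+n h)) ⟩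
    transversalSum h g + 2 ^ suc h * 0 * g (suc h)
      ≡⟨ cong (λ z → transversalSum h g + z * g (suc h)) (*-zeroʳ (2 ^ suc h)) ⟩
    transversalSum h g + 0
      ≡⟨ +-identityʳ _ ⟩
    transversalSum h g ∎
    where open ≡-Reasoning

  transversalSum-suc : ∀ h g →
    transversalSum (suc h) g ≡ transversalSum h g + 2 * transversalSum h (g ∘ suc)
  transversalSum-suc h g = begin
    transversalSum (suc h) g
      ≡⟨ Σℕ.sumUpTo-suc (suc h) (transversalTerm (suc h) g) ⟩
    t g 0 + sumUpTo (suc h) (transversalTerm (suc h) g ∘ suc)
      ≡⟨ cong (t g 0 +_) (Σℕ.sumUpTo-cong (suc h) (λ {k} _ → transversalTerm-pascal h g k)) ⟩
    t g 0 + sumUpTo (suc h) (λ k → 2 * t (g ∘ suc) k + t g (suc k))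
      ≡⟨ cong (t g 0 +_) (Σℕ.sumList-∙ (upTo (suc h)) (λ k → 2 * t (g ∘ suc) k) (t g ∘ suc)) ⟩
    t g 0 + (sumUpTo (suc h) (λ k → 2 * t (g ∘ suc) k) + sumUpTo (suc h) (t g ∘ suc))
      ≡⟨ cong (λ z → t g 0 + (z + sumUpTo (suc h) (t g ∘ suc)))
              (Scaleℕ.sumList-homo 2 (upTo (suc h)) (t (g ∘ suc))) ⟨
    t g 0 + (2 * transversalSum h (g ∘ suc) + sumUpTo (suc h) (t g ∘ suc))
      ≡⟨ solve 3 (λ x y z → x :+ (y :+ z) := (x :+ z) :+ y) refl (t g 0) _ _ ⟩
    (t g 0 + sumUpTo (suc h) (t g ∘ suc)) + 2 * transversalSum h (g ∘ suc)
      ≡⟨ cong (_+ 2 * transversalSum h (g ∘ suc))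
              (trans (sym (Σℕ.sumUpTo-suc (suc h) (t g))) (transversalSum-extend h g)) ⟩
    transversalSum h g + 2 * transversalSum h (g ∘ suc) ∎
    where
    open ≡-Reasoning
    open +-*-Solver
    t : (ℕ → ℕ) → ℕ → ℕ
    t = transversalTerm h

  avoidingSum : ℕ → (ℕ → ℕ) → ℕ
  avoidingSum i g = sumSubsets (suc i) (λ u → if inSumset u i then 0 else g (card u))

  avoidingSum-+2 : ∀ i g → avoidingSum (2 + i) g ≡ avoidingSum i g + 2 * avoidingSum i (g ∘ suc)
  avoidingSum-+2 i g = begin
    avoidingSum (2 + i) g
      ≡⟨ cong₂ _+_ (Σℕ.sumSubsets-∷ʳ (suc i) (f ∘ (true ∷_)))
                   (Σℕ.sumSubsets-∷ʳ (suc i) (f ∘ (false ∷_))) ⟩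
    (Σ[ true , true ] + Σ[ true , false ]) + (Σ[ false , true ] + Σ[ false , false ])
      ≡⟨ cong₂ _+_ (cong₂ _+_ (corners true true) (corners true false))
                   (cong₂ _+_ (corners false true) (corners false false)) ⟩
    (sumSubsets (suc i) (λ _ → 0) + A′) + (A′ + A)
      ≡⟨ cong (λ z → (z + A′) + (A′ + A)) (Σℕ.sumSubsets-ε (suc i)) ⟩
    A′ + (A′ + A)
      ≡⟨ solve 2 (λ a a′ → a′ :+ (a′ :+ a) := a :+ con 2 :* a′) refl A A′ ⟩
    A + 2 * A′ ∎
    where
    open ≡-Reasoning
    open +-*-Solver
    A A′ : ℕ
    A  = avoidingSum i g
    A′ = avoidingSum i (g ∘ suc)
    f : Sub (3 + i) → ℕ
    f u = if inSumset u (2 + i) then 0 else g (card u)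
    Σ[_,_] : Bool → Bool → ℕ
    Σ[ b , b′ ] = sumSubsets (suc i) (λ w → f (b ∷ (w ∷ʳ b′)))
    corner : ∀ b b′ (w : Sub (suc i)) →
             f (b ∷ (w ∷ʳ b′)) ≡ (if (b ∧ b′) ∨ inSumset w i then 0 else g (card (b ∷ b′ ∷ w)))
    corner true  b′ w = cong₂ (λ x c → if x then 0 else g c)
                              (inSumset-outerPair i true b′ w) (cong suc (card-∷ʳ w b′))
    corner false b′ w = cong₂ (λ x c → if x then 0 else g c)
                              (inSumset-outerPair i false b′ w) (card-∷ʳ w b′)
    corners : ∀ b b′ → Σ[ b , b′ ]
              ≡ sumSubsets (suc i) (λ w → if (b ∧ b′) ∨ inSumset w i then 0 else g (card (b ∷ b′ ∷ w)))
    corners b b′ = Σℕ.sumSubsets-cong (suc i) (corner b b′)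

  halfIdx-+2 : ∀ i → halfIdx (2 + i) ≡ suc (halfIdx i)
  halfIdx-+2 i with i % 2
  ... | zero  = m/n≡1+[m∸n]/n {2 + i} {2} (s≤s (s≤s z≤n))
  ... | suc _ = m/n≡1+[m∸n]/n {2 + i + 1} {2} (s≤s (s≤s z≤n))

  avoidingSum≡transversalSum : ∀ i g → avoidingSum i g ≡ transversalSum (halfIdx i) g
  avoidingSum≡transversalSum zero          g =
    solve 1 (λ x → x := con 1 :* con 1 :* x :+ con 0) refl (g 0)
    where open +-*-Solver
  avoidingSum≡transversalSum (suc zero)    g =
    solve 2 (λ x y → (con 0 :+ y) :+ (y :+ x)
                     := con 1 :* con 1 :* x :+ (con 2 :* con 1 :* y :+ con 0))
          refl (g 0) (g 1)
    where open +-*-Solver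
  avoidingSum≡transversalSum (suc (suc i)) g = begin
    avoidingSum (2 + i) g
      ≡⟨ avoidingSum-+2 i g ⟩
    avoidingSum i g + 2 * avoidingSum i (g ∘ suc)
      ≡⟨ cong₂ (λ x y → x + 2 * y) (avoidingSum≡transversalSum i g)
                                   (avoidingSum≡transversalSum i (g ∘ suc)) ⟩
    transversalSum (halfIdx i) g + 2 * transversalSum (halfIdx i) (g ∘ suc)
      ≡⟨ transversalSum-suc (halfIdx i) g ⟨
    transversalSum (suc (halfIdx i)) g
      ≡⟨ cong (λ h → transversalSum h g) (halfIdx-+2 i) ⟨
    transversalSum (halfIdx (2 + i)) g ∎
    where open ≡-Reasoning

  avoids : ∀ {n} → Sub n → ℕ → Bool
  avoids S i = if inSumset S i then false else true

  avoidCount : (n : ℕ) → ℕ → ℕ → ℕ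
  avoidCount n r i = count n (λ S → avoids S i ∧ (card S ≡ᵇ r))

  -- The conjuncts are ordered so that restricting to |S| = r reduces by computation.
  hitCount : (n : ℕ) → ℕ → ℕ → ℕ
  hitCount n r i = count n (λ S → (card S ≡ᵇ r) ∧ inSumset S i)

  avoidCount≡transversalSum : ∀ n r i → i < n →
    avoidCount n r i ≡ transversalSum (halfIdx i) (binomDiff (n ∸ i ∸ 1) r)
  avoidCount≡transversalSum n r i i<n with t , refl ← m≤n⇒∃[o]m+o≡n i<n = begin
    avoidCount (suc i + t) r i
      ≡⟨ Σℕ.sumSubsets-++ (suc i) t (λ S → if avoids S i ∧ (card S ≡ᵇ r) then 1 else 0) ⟩
    sumSubsets (suc i) (λ u → count t (λ v → avoids (u ++ v) i ∧ (card (u ++ v) ≡ᵇ r)))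
      ≡⟨ Σℕ.sumSubsets-cong (suc i) prefixCount ⟩
    avoidingSum i (binomDiff t r)
      ≡⟨ avoidingSum≡transversalSum i (binomDiff t r) ⟩
    transversalSum (halfIdx i) (binomDiff t r)
      ≡⟨ cong (λ m → transversalSum (halfIdx i) (binomDiff m r)) t≡n∸i∸1 ⟩
    transversalSum (halfIdx i) (binomDiff (suc i + t ∸ i ∸ 1) r) ∎
    where
    open ≡-Reasoning
    t≡n∸i∸1 : t ≡ suc i + t ∸ i ∸ 1
    t≡n∸i∸1 = sym (cong (_∸ 1) (trans (cong (_∸ i) (sym (+-suc i t))) (m+n∸m≡n i (suc t))))
    byCases : ∀ c x → count t (λ v → (if x then false else true) ∧ (c + card v ≡ᵇ r))
                      ≡ (if x then 0 else binomDiff t r c)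
    byCases c true  = Σℕ.sumSubsets-ε t
    byCases c false = count-card-offset t c r
    prefixCount : ∀ u → count t (λ v → avoids (u ++ v) i ∧ (card (u ++ v) ≡ᵇ r))
                        ≡ (if inSumset u i then 0 else binomDiff t r (card u))
    prefixCount u = trans
      (Σℕ.sumSubsets-cong t (λ v →
        cong₂ (λ x c → if (if x then false else true) ∧ (c ≡ᵇ r) then 1 else 0)
              (inSumset-++ u v i ≤-refl) (card-++ u v)))
      (byCases (card u) (inSumset u i))

  hitCount-reflect : ∀ N r {i j} → i + j ≡ N + N → hitCount (suc N) r i ≡ hitCount (suc N) r j
  hitCount-reflect N r {i} {j} i+j≡2N = trans
    (sym (Σℕ.sumSubsets-reverse (suc N) (λ S → if (card S ≡ᵇ r) ∧ inSumset S i then 1 else 0)))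
    (Σℕ.sumSubsets-cong (suc N) (λ S →
      cong₂ (λ c x → if (c ≡ᵇ r) ∧ x then 1 else 0)
            (card-reverse S) (inSumset-reverse N S {i} {j} i+j≡2N)))

  sumOnCard : (n : ℕ) → ℕ → (Sub n → ℕ) → ℕ
  sumOnCard n r X = sumSubsets n (λ S → if card S ≡ᵇ r then X S else 0)

  sumOnCard-sumsetSize : ∀ n r → sumOnCard n r sumsetSize ≡ sumUpTo (2 * n ∸ 1) (hitCount n r)
  sumOnCard-sumsetSize n r = trans (Σℕ.sumSubsets-cong n (λ S → restrict (card S ≡ᵇ r) S))
                                   (Σℕ.sumSubsets-sumList n (upTo (2 * n ∸ 1)) _)
    where
    restrict : ∀ b (S : Sub n) → (if b then sumsetSize S else 0)
               ≡ sumUpTo (2 * n ∸ 1) (λ i → if b ∧ inSumset S i then 1 else 0)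
    restrict true  S = refl
    restrict false S = sym (Σℕ.sumList-ε (upTo (2 * n ∸ 1)))

  sumUpTo-palindrome : ∀ N f → (∀ {i j} → i + j ≡ N + N → f i ≡ f j) →
                       sumUpTo (2 * suc N ∸ 1) f ≡ 2 * sumUpTo N f + f N
  sumUpTo-palindrome N f symmetric = begin
    sumUpTo (N + (suc N + 0)) f
      ≡⟨ cong (λ m → sumUpTo (N + m) f) (+-identityʳ (suc N)) ⟩
    sumUpTo (N + suc N) f
      ≡⟨ Σℕ.sumUpTo-+ N (suc N) f ⟩
    sumUpTo N f + sumUpTo (suc N) (f ∘ (N +_))
      ≡⟨ cong (sumUpTo N f +_) (Σℕ.sumUpTo-suc N _) ⟩
    sumUpTo N f + (f (N + 0) + sumUpTo N (λ j → f (N + suc j)))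
      ≡⟨ cong₂ (λ x y → sumUpTo N f + (f x + y)) (+-identityʳ N) (Σℕ.sumUpTo-cong N mirror) ⟩
    sumUpTo N f + (f N + sumUpTo N (λ j → f (N ∸ suc j)))
      ≡⟨ cong (λ x → sumUpTo N f + (f N + x)) (Σℕ.sumUpTo-reverse N f) ⟩
    sumUpTo N f + (f N + sumUpTo N f)
      ≡⟨ solve 2 (λ s x → s :+ (x :+ s) := con 2 :* s :+ x) refl (sumUpTo N f) (f N) ⟩
    2 * sumUpTo N f + f N ∎
    where
    open ≡-Reasoning
    open +-*-Solver
    mirror : ∀ {j} → j < N → f (N + suc j) ≡ f (N ∸ suc j)
    mirror {j} j<N =
      symmetric (trans (+-assoc N (suc j) (N ∸ suc j)) (cong (N +_) (m+[n∸m]≡n j<N)))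

module Rationals where

  open import Data.Integer as ℤ using (+_)
  import Data.Integer.Properties as ℤ
  open import Data.Nat as ℕ using (ℕ; zero; suc)
  import Data.Nat.Properties as ℕ
  open import Data.Rational
  open import Data.Rational.Properties
  open import Data.Rational.Unnormalised as ℚᵘ using (ℚᵘ; mkℚᵘ; *≡*)
  import Data.Rational.Unnormalised.Properties as ℚᵘ
  open import Relation.Binary.PropositionalEquality
  open import Defs using (ℕ→ℚ; frac; _^Q_)

  -- ℕ→ℚ k and frac a (suc b) are definitionally fromℚᵘ of mkℚᵘ (+ k) 0 and mkℚᵘ (+ a) b.
  fromℚᵘ-+ : ∀ x y → fromℚᵘ (x ℚᵘ.+ y) ≡ fromℚᵘ x + fromℚᵘ y
  fromℚᵘ-+ x y = toℚᵘ-injective (ℚᵘ.≃-trans (toℚᵘ-fromℚᵘ (x ℚᵘ.+ y)) (ℚᵘ.≃-sym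
    (ℚᵘ.≃-trans (toℚᵘ-homo-+ (fromℚᵘ x) (fromℚᵘ y))
                (ℚᵘ.+-cong (toℚᵘ-fromℚᵘ x) (toℚᵘ-fromℚᵘ y)))))

  fromℚᵘ-* : ∀ x y → fromℚᵘ (x ℚᵘ.* y) ≡ fromℚᵘ x * fromℚᵘ y
  fromℚᵘ-* x y = toℚᵘ-injective (ℚᵘ.≃-trans (toℚᵘ-fromℚᵘ (x ℚᵘ.* y)) (ℚᵘ.≃-sym
    (ℚᵘ.≃-trans (toℚᵘ-homo-* (fromℚᵘ x) (fromℚᵘ y))
                (ℚᵘ.*-cong (toℚᵘ-fromℚᵘ x) (toℚᵘ-fromℚᵘ y)))))

  ℕ→ℚ-+ : ∀ a b → ℕ→ℚ (a ℕ.+ b) ≡ ℕ→ℚ a + ℕ→ℚ b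
  ℕ→ℚ-+ a b = trans
    (fromℚᵘ-cong {mkℚᵘ (+ (a ℕ.+ b)) 0} {mkℚᵘ (+ a) 0 ℚᵘ.+ mkℚᵘ (+ b) 0} (*≡* eq))
    (fromℚᵘ-+ (mkℚᵘ (+ a) 0) (mkℚᵘ (+ b) 0))
    where
    eq : + (a ℕ.+ b) ℤ.* + 1 ≡ (+ a ℤ.* + 1 ℤ.+ + b ℤ.* + 1) ℤ.* + 1
    eq rewrite ℤ.*-identityʳ (+ a) | ℤ.*-identityʳ (+ b) = refl

  ℕ→ℚ-* : ∀ a b → ℕ→ℚ (a ℕ.* b) ≡ ℕ→ℚ a * ℕ→ℚ b
  ℕ→ℚ-* a b = trans
    (fromℚᵘ-cong {mkℚᵘ (+ (a ℕ.* b)) 0} {mkℚᵘ (+ a) 0 ℚᵘ.* mkℚᵘ (+ b) 0}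
                 (*≡* (cong (ℤ._* + 1) (ℤ.pos-* a b))))
    (fromℚᵘ-* (mkℚᵘ (+ a) 0) (mkℚᵘ (+ b) 0))

  frac-* : ∀ a c .{{_ : ℕ.NonZero c}} → frac a c * ℕ→ℚ c ≡ ℕ→ℚ a
  frac-* a (suc c) = trans
    (sym (fromℚᵘ-* (mkℚᵘ (+ a) c) (mkℚᵘ (+ suc c) 0)))
    (fromℚᵘ-cong {mkℚᵘ (+ a) c ℚᵘ.* mkℚᵘ (+ suc c) 0} {mkℚᵘ (+ a) 0} (*≡* eq))
    where
    eq : + a ℤ.* + suc c ℤ.* + 1 ≡ + a ℤ.* + (suc c ℕ.* 1)
    eq rewrite ℤ.*-identityʳ (+ a ℤ.* + suc c) | ℕ.*-identityʳ (suc c) = refl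

  ÷-*-cancel : ∀ x y .{{_ : NonZero y}} → (x ÷ y) * y ≡ x
  ÷-*-cancel x y = trans (*-assoc x (1/ y) y) (trans (cong (x *_) (*-inverseˡ y)) (*-identityʳ x))

  *-÷-cancel : ∀ x y .{{_ : NonZero y}} → (x * y) ÷ y ≡ x
  *-÷-cancel x y = trans (*-assoc x y (1/ y)) (trans (cong (x *_) (*-inverseʳ y)) (*-identityʳ x))

  *-cancelʳ : ∀ {x y} w .{{_ : NonZero w}} → x * w ≡ y * w → x ≡ y
  *-cancelʳ {x} {y} w eq = trans (sym (*-÷-cancel x w)) (trans (cong (_÷ w) eq) (*-÷-cancel y w))

  ℕ→ℚ-pos : ∀ k .{{_ : ℕ.NonZero k}} → Positive (ℕ→ℚ k)
  ℕ→ℚ-pos (suc k) = normalize-pos (suc k) 1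

  frac-unique : ∀ {x} a c .{{_ : ℕ.NonZero c}} → x * ℕ→ℚ c ≡ ℕ→ℚ a → x ≡ frac a c
  frac-unique a c eq =
    *-cancelʳ (ℕ→ℚ c) {{pos⇒nonZero (ℕ→ℚ c) {{ℕ→ℚ-pos c}}}} (trans eq (sym (frac-* a c)))

  ^Q-pos : ∀ {x} k .{{_ : Positive x}} → Positive (x ^Q k)
  ^Q-pos zero        = _
  ^Q-pos {x} (suc k) = pos*pos⇒pos x (x ^Q k) {{^Q-pos k}}

  1-p-pos : ∀ {p} → p < 1ℚ → Positive (1ℚ - p)
  1-p-pos {p} p<1 = positive (subst (_< 1ℚ - p) (+-inverseʳ p) (+-monoˡ-< (- p) p<1))

open import Defs
open import Data.Nat using (ℕ; suc; _∸_)
import Data.Nat as ℕ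
open import Data.Nat.Combinatorics using (_C_)
open import Data.Rational using (ℚ; 0ℚ; 1ℚ; _+_; _*_; _-_; _<_)
open import Data.Product using (_×_)
open import Relation.Binary.PropositionalEquality using (_≡_)
open import Data.Product using (_,_)
open import Relation.Binary.PropositionalEquality using (trans)

module Probability where

  open import Data.Bool using (Bool; true; false; T; if_then_else_; _∧_)
  open import Data.Bool.Properties using (T-∧)
  open import Data.List using (List; upTo)
  open import Data.List.Properties using (foldr-universal)
  import Data.Nat.Properties as ℕ
  open import Data.Product using (proj₂)
  open import Data.Rational using (Positive; positive; ≢-nonZero)
  open import Data.Rational.Properties
  open import Data.Rational.Solver using (module +-*-Solver)
  open import Function using (_∘_; Equivalence)
  open import Relation.Binary.PropositionalEquality
    using (refl; sym; cong; cong₂; _≢_; ≢-sym; module ≡-Reasoning)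
  open import Relation.Nullary using (yes; no; contradiction)
  open FiniteSums
  open Counting
  open Rationals

  module Σℚ = Sums +-0-isCommutativeMonoid
  module Castℕ→ℚ = SumHomomorphism
    ℕ.+-0-isCommutativeMonoid +-0-isCommutativeMonoid ℕ→ℚ refl ℕ→ℚ-+
  module Scaleℚˡ (c : ℚ) = SumHomomorphism
    +-0-isCommutativeMonoid +-0-isCommutativeMonoid (c *_) (*-zeroʳ c) (*-distribˡ-+ c)
  module Scaleℚʳ (c : ℚ) = SumHomomorphism
    +-0-isCommutativeMonoid +-0-isCommutativeMonoid (_* c) (*-zeroˡ c) (*-distribʳ-+ c)

  -- Pr and Ex are folds over allSubs n whose step functions are local to Defs and cannot be
  -- named; the metavariables below are solved by unification against them.
  mutual
    private
      prFold : (n : ℕ) → ℚ → (Sub n → Bool) → List (Sub n) → ℚ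
      prFold = _

    Pr-sumList : ∀ n p E →
                 Pr n p E ≡ Σℚ.sumList (allSubs n) (λ S → if E S then weight n p S else 0ℚ)
    Pr-sumList n p E with allSubs n
    ... | Ss = foldr-universal (prFold n p E) _ _ refl (λ _ _ → refl) Ss

  mutual
    private
      exFold : (n : ℕ) → ℚ → (Sub n → ℕ) → List (Sub n) → ℚ
      exFold = _

    Ex-sumList : ∀ n p X → Ex n p X ≡ Σℚ.sumList (allSubs n) (λ S → weight n p S * ℕ→ℚ (X S))
    Ex-sumList n p X with allSubs n
    ... | Ss = foldr-universal (exFold n p X) _ _ refl (λ _ _ → refl) Ss

  cardWeight : ℕ → ℚ → ℕ → ℚ
  cardWeight n p r = p ^Q r * ((1ℚ - p) ^Q (n ∸ r))

  cardWeight-pos : ∀ n {p} r → 0ℚ < p → p < 1ℚ → Positive (cardWeight n p r)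
  cardWeight-pos n {p} r 0<p p<1 =
    pos*pos⇒pos (p ^Q r) {{^Q-pos r {{positive 0<p}}}}
                ((1ℚ - p) ^Q (n ∸ r)) {{^Q-pos (n ∸ r) {{1-p-pos p<1}}}}

  Pr-cardEvent : ∀ n p r (E : Sub n → Bool) → (∀ S → T (E S) → card S ≡ r) →
                 Pr n p E ≡ ℕ→ℚ (count n E) * cardWeight n p r
  Pr-cardEvent n p r E onCard = begin
    Pr n p E
      ≡⟨ trans (Pr-sumList n p E) (Σℚ.sumList-allSubs n _) ⟩
    Σℚ.sumSubsets n (λ S → if E S then weight n p S else 0ℚ)
      ≡⟨ Σℚ.sumSubsets-cong n (λ S → restrict S (E S) (onCard S)) ⟩
    Σℚ.sumSubsets n (λ S → ℕ→ℚ (if E S then 1 else 0) * w)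
      ≡⟨ Scaleℚʳ.sumSubsets-homo w n _ ⟨
    Σℚ.sumSubsets n (λ S → ℕ→ℚ (if E S then 1 else 0)) * w
      ≡⟨ cong (_* w) (Castℕ→ℚ.sumSubsets-homo n _) ⟨
    ℕ→ℚ (count n E) * w ∎
    where
    open ≡-Reasoning
    w : ℚ
    w = cardWeight n p r
    restrict : ∀ S b → (T b → card S ≡ r) →
               (if b then weight n p S else 0ℚ) ≡ ℕ→ℚ (if b then 1 else 0) * w
    restrict S true  onCard = trans (cong (cardWeight n p) (onCard _)) (sym (*-identityˡ w))
    restrict S false _      = sym (*-zeroˡ w)

  Ex-byCard : ∀ n p (X : Sub n → ℕ) →
              Ex n p X ≡ Σℚ.sumUpTo (suc n) (λ r → cardWeight n p r * ℕ→ℚ (sumOnCard n r X))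
  Ex-byCard n p X = begin
    Ex n p X
      ≡⟨ trans (Ex-sumList n p X) (Σℚ.sumList-allSubs n _) ⟩
    Σℚ.sumSubsets n (λ S → weight n p S * ℕ→ℚ (X S))
      ≡⟨ Σℚ.sumSubsets-byCard n _ ⟩
    Σℚ.sumUpTo (suc n) (λ r → Σℚ.sumSubsets n (weightedOnCard r))
      ≡⟨ Σℚ.sumUpTo-cong (suc n) (λ {r} _ → onCard r) ⟩
    Σℚ.sumUpTo (suc n) (λ r → cardWeight n p r * ℕ→ℚ (sumOnCard n r X)) ∎
    where
    open ≡-Reasoning
    weightedOnCard : ℕ → Sub n → ℚ
    weightedOnCard r S = if card S ℕ.≡ᵇ r then weight n p S * ℕ→ℚ (X S) else 0ℚ
    restrict : ∀ r S b → (T b → card S ≡ r) → (if b then weight n p S * ℕ→ℚ (X S) else 0ℚ)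
                                             ≡ cardWeight n p r * ℕ→ℚ (if b then X S else 0)
    restrict r S true  onCard = cong (λ c → cardWeight n p c * ℕ→ℚ (X S)) (onCard _)
    restrict r S false _      = sym (*-zeroʳ (cardWeight n p r))
    onCard : ∀ r → Σℚ.sumSubsets n (weightedOnCard r) ≡ cardWeight n p r * ℕ→ℚ (sumOnCard n r X)
    onCard r = begin
      Σℚ.sumSubsets n (weightedOnCard r)
        ≡⟨ Σℚ.sumSubsets-cong n (λ S → restrict r S (card S ℕ.≡ᵇ r) (ℕ.≡ᵇ⇒≡ (card S) r)) ⟩
      Σℚ.sumSubsets n (λ S → cardWeight n p r * ℕ→ℚ (if card S ℕ.≡ᵇ r then X S else 0))
        ≡⟨ Scaleℚˡ.sumSubsets-homo (cardWeight n p r) n _ ⟨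
      cardWeight n p r * Σℚ.sumSubsets n (λ S → ℕ→ℚ (if card S ℕ.≡ᵇ r then X S else 0))
        ≡⟨ cong (cardWeight n p r *_) (Castℕ→ℚ.sumSubsets-homo n _) ⟨
      cardWeight n p r * ℕ→ℚ (sumOnCard n r X) ∎

  CondPr-* : ∀ n p (E F : Sub n → Bool) → Pr n p F ≢ 0ℚ →
             CondPr n p E F * Pr n p F ≡ Pr n p (λ S → E S ∧ F S)
  CondPr-* n p E F PrF≢0 with Pr n p F ≟ 0ℚ
  ... | yes PrF≡0 = contradiction PrF≡0 PrF≢0
  ... | no  PrF≢0 = ÷-*-cancel _ _ {{≢-nonZero PrF≢0}}

  -- P(i ∉ A + A ∧ |A| = r) and P(|A| = r) are both counts times p^r q^(n-r) > 0, which cancels.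
  Pcond-count : ∀ n {p} r i → 0ℚ < p → p < 1ℚ → r ℕ.≤ n →
                Pcond n p r i * ℕ→ℚ (n C r) ≡ ℕ→ℚ (avoidCount n r i)
  Pcond-count n {p} r i 0<p p<1 r≤n = *-cancelʳ w {{pos⇒nonZero w {{w-pos}}}} (begin
    Pcond n p r i * ℕ→ℚ (n C r) * w    ≡⟨ *-assoc (Pcond n p r i) (ℕ→ℚ (n C r)) w ⟩
    Pcond n p r i * (ℕ→ℚ (n C r) * w)  ≡⟨ cong (Pcond n p r i *_) PrF ⟨
    Pcond n p r i * Pr n p F           ≡⟨ CondPr-* n p E F PrF≢0 ⟩
    Pr n p (λ S → E S ∧ F S)
      ≡⟨ Pr-cardEvent n p r _ (λ S → onCard S ∘ proj₂ ∘ Equivalence.to T-∧) ⟩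
    ℕ→ℚ (avoidCount n r i) * w         ∎)
    where
    open ≡-Reasoning
    w : ℚ
    w = cardWeight n p r
    w-pos : Positive w
    w-pos = cardWeight-pos n r 0<p p<1
    E F : Sub n → Bool
    E S = avoids S i
    F S = card S ℕ.≡ᵇ r
    onCard : ∀ S → T (F S) → card S ≡ r
    onCard S = ℕ.≡ᵇ⇒≡ (card S) r
    PrF : Pr n p F ≡ ℕ→ℚ (n C r) * w
    PrF = trans (Pr-cardEvent n p r F onCard) (cong (λ c → ℕ→ℚ c * w) (count-card n r))
    PrF≢0 : Pr n p F ≢ 0ℚ
    PrF≢0 rewrite PrF = ≢-sym (<⇒≢ (positive⁻¹ (ℕ→ℚ (n C r) * w) {{Cw-pos}}))
      where
      Cw-pos : Positive (ℕ→ℚ (n C r) * w)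
      Cw-pos = pos*pos⇒pos (ℕ→ℚ (n C r)) {{ℕ→ℚ-pos (n C r) {{ℕ.>-nonZero (nCk>0 r≤n)}}}}
                           w {{w-pos}}

  Pcond≡Pformula : ∀ n {p} r i → 0ℚ < p → p < 1ℚ → r ℕ.≤ n → i ℕ.< n →
                   Pcond n p r i ≡ Pformula n r i
  Pcond≡Pformula n r i 0<p p<1 r≤n i<n = trans
    (frac-unique (avoidCount n r i) (n C r) {{ℕ.>-nonZero (nCk>0 r≤n)}}
                 (Pcond-count n r i 0<p p<1 r≤n))
    (cong (λ a → frac a (n C r)) (avoidCount≡transversalSum n r i i<n))

  hitCount≡C*[1-Pcond] : ∀ n {p} r i → 0ℚ < p → p < 1ℚ → r ℕ.≤ n →
                         ℕ→ℚ (hitCount n r i) ≡ ℕ→ℚ (n C r) * (1ℚ - Pcond n p r i)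
  hitCount≡C*[1-Pcond] n {p} r i 0<p p<1 r≤n = begin
    Hit                    ≡⟨ solve 2 (λ a h → h := (a :+ h) :- a) refl Avoid Hit ⟩
    (Avoid + Hit) - Avoid  ≡⟨ cong₂ _-_ Cnr≡Avoid+Hit (Pcond-count n r i 0<p p<1 r≤n) ⟨
    Cnr - P * Cnr          ≡⟨ solve 2 (λ c q → c :- q :* c := c :* (con 1ℚ :- q)) refl Cnr P ⟩
    Cnr * (1ℚ - P)         ∎
    where
    open ≡-Reasoning
    open +-*-Solver
    P Cnr Avoid Hit : ℚ
    P = Pcond n p r i
    Cnr = ℕ→ℚ (n C r)
    Avoid = ℕ→ℚ (avoidCount n r i)
    Hit = ℕ→ℚ (hitCount n r i)
    Cnr≡Avoid+Hit : Cnr ≡ Avoid + Hit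
    Cnr≡Avoid+Hit = trans
      (cong ℕ→ℚ (trans (sym (count-card n r))
                       (count-split n (λ S → inSumset S i) (λ S → card S ℕ.≡ᵇ r))))
      (ℕ→ℚ-+ (avoidCount n r i) (hitCount n r i))

  Ex-sumsetSize-onCard : ∀ N {p} r → 0ℚ < p → p < 1ℚ → r ℕ.≤ suc N →
    cardWeight (suc N) p r * ℕ→ℚ (sumOnCard (suc N) r sumsetSize)
    ≡ ℕ→ℚ (suc N C r) * (p ^Q r) * ((1ℚ - p) ^Q (suc N ∸ r))
      * (ℕ→ℚ 2 * ΣQ N (λ i → 1ℚ - Pcond (suc N) p r i) + (1ℚ - Pcond (suc N) p r N))
  Ex-sumsetSize-onCard N {p} r 0<p p<1 r≤n = begin
    w * ℕ→ℚ (sumOnCard n r sumsetSize)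
      ≡⟨ cong (λ z → w * ℕ→ℚ z) (trans (sumOnCard-sumsetSize n r)
                                        (sumUpTo-palindrome N hit (hitCount-reflect N r))) ⟩
    w * ℕ→ℚ (2 ℕ.* Σℕ.sumUpTo N hit ℕ.+ hit N)
      ≡⟨ cong (w *_) (trans (ℕ→ℚ-+ (2 ℕ.* Σℕ.sumUpTo N hit) (hit N))
                            (cong (_+ ℕ→ℚ (hit N)) (ℕ→ℚ-* 2 (Σℕ.sumUpTo N hit)))) ⟩
    w * (ℕ→ℚ 2 * ℕ→ℚ (Σℕ.sumUpTo N hit) + ℕ→ℚ (hit N))
      ≡⟨ cong (λ z → w * (ℕ→ℚ 2 * z + ℕ→ℚ (hit N))) (Castℕ→ℚ.sumList-homo (upTo N) hit) ⟩
    w * (ℕ→ℚ 2 * Σℚ.sumUpTo N (ℕ→ℚ ∘ hit) + ℕ→ℚ (hit N))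
      ≡⟨ cong₂ (λ s x → w * (ℕ→ℚ 2 * s + x)) (Σℚ.sumList-cong (upTo N) (λ {i} _ → hit≡ i)) (hit≡ N) ⟩
    w * (ℕ→ℚ 2 * Σℚ.sumUpTo N (λ i → Cnr * (1ℚ - Pcond n p r i)) + Cnr * X)
      ≡⟨ cong (λ s → w * (ℕ→ℚ 2 * s + Cnr * X))
              (Scaleℚˡ.sumList-homo Cnr (upTo N) (λ i → 1ℚ - Pcond n p r i)) ⟨
    w * (ℕ→ℚ 2 * (Cnr * S) + Cnr * X)
      ≡⟨ solve 6 (λ c a b k s x → (a :* b) :* (k :* (c :* s) :+ c :* x)
                                  := c :* a :* b :* (k :* s :+ x))
               refl Cnr (p ^Q r) ((1ℚ - p) ^Q (n ∸ r)) (ℕ→ℚ 2) S X ⟩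
    Cnr * (p ^Q r) * ((1ℚ - p) ^Q (n ∸ r)) * (ℕ→ℚ 2 * S + X) ∎
    where
    open ≡-Reasoning
    open +-*-Solver
    n : ℕ
    n = suc N
    w Cnr S X : ℚ
    w = cardWeight n p r
    Cnr = ℕ→ℚ (n C r)
    S = ΣQ N (λ i → 1ℚ - Pcond n p r i)
    X = 1ℚ - Pcond n p r N
    hit : ℕ → ℕ
    hit = hitCount n r
    hit≡ : ∀ i → ℕ→ℚ (hit i) ≡ Cnr * (1ℚ - Pcond n p r i)
    hit≡ i = hitCount≡C*[1-Pcond] n r i 0<p p<1 r≤n

open Probability

theorem1p1 : (n : ℕ) → 1 ℕ.≤ n → (p : ℚ) → 0ℚ < p → p < 1ℚ →
    (Ex n p sumsetSize ≡
      ΣQ (suc n) (λ r →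
        ℕ→ℚ (n C r) * (p ^Q r) * ((1ℚ - p) ^Q (n ∸ r))
          * (ℕ→ℚ 2 * ΣQ (n ∸ 1) (λ i → 1ℚ - Pcond n p r i)
             + (1ℚ - Pcond n p r (n ∸ 1)))))
    × ((r i : ℕ) → r ℕ.≤ n → i ℕ.≤ n ∸ 1 → Pcond n p r i ≡ Pformula n r i)
theorem1p1 (suc N) _ p 0<p p<1 =
    trans (Ex-byCard (suc N) p sumsetSize)
          (Σℚ.sumUpTo-cong (2 ℕ.+ N) (λ r<2+N → Ex-sumsetSize-onCard N _ 0<p p<1 (ℕ.≤-pred r<2+N)))
  , (λ r i r≤n i≤N → Pcond≡Pformula (suc N) r i 0<p p<1 r≤n (ℕ.s≤s i≤N))
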